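{- Let $b\geq 2$ be an even integer. Then the maximum length $t$ of an arithmetic progression $n, n+(b-1),\dots,n+(t-1)(b-1)$ of positive integers all of which are $b$-anti-Niven is $2b+1$. Moreover, there exist infinitely many positive integers $n$ such that $n+j(b-1)$ is $b$-anti-Niven for all $0\leq j\leq 2b$.
   Context: For a positive integer $n$ with base-$b$ expansion $n=\sum_{j=0}^m a_jb^j$ ($0\leq a_j\leq b-1$), $s_b(n)=\sum_{j=0}^m a_j$. A positive integer $n$ is $b$-anti-Niven if $\gcd(n,s_b(n))=1$. -}

module Defs where

open import Data.Nat using (ℕ; zero; suc; _+_; _*_; _∸_; _<_; _≤_)
open import Data.Nat.DivMod using (_/_; _%_)
open import Data.Nat.GCD using (gcd)
open import Data.Product using (_×_)
open import Relation.Binary.PropositionalEquality using (_≡_)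

-- base-(suc (suc k)) digit sum with fuel; with fuel ≥ number of digits
-- (fuel = n always suffices, since n / b < n for n > 0) it is exact.
digitSumFuel : ℕ → ℕ → ℕ → ℕ
digitSumFuel k zero    n = 0
digitSumFuel k (suc f) n = n % suc (suc k) + digitSumFuel k f (n / suc (suc k))

s : ℕ → ℕ → ℕ
s zero          n = 0   -- unused: b ≥ 2 in all uses
s (suc zero)    n = 0
s (suc (suc k)) n = digitSumFuel k n n

AntiNiven : ℕ → ℕ → Set
AntiNiven b n = 0 < n × gcd n (s b n) ≡ 1

APAntiNiven : ℕ → ℕ → ℕ → Set
APAntiNiven b n t = ∀ j → j < t → AntiNiven b (n + j * (b ∸ 1))

{-# OPTIONS --safe #-}
-- Write b = k + 2.  Upper bound (b even): for i = n mod b the term n + i(b − 1) is a multiple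
-- q b of b.  If q b and q b + 2(b − 1) = (q + 1) b + (b − 2) are both anti-Niven then b ∣ q + 1,
-- for otherwise their digit sums s(q) and s(q) + b − 1 have different parities while both
-- numbers are even.  The term with index i + b is (q + b − 1) b, so the same argument there
-- gives b ∣ q + b, hence b ∣ b − 1: no progression has 2b + 2 terms.
--
-- Existence (any b ≥ 2): take terms x_j = y_j + A b^L with y_j = (j + 1)(b − 1) < b^L, so that
-- s(x_j) = s(y_j) + s(A), where s(y_j) is b − 1, or 2(b − 1) with b ∣ y_j + 1.  Let c be a
-- multiple of every y_j, D = c b^7 + 1 and F = c b^6 + 1, and let A be a multiple of D F with
-- s(A) = D − (b − 1).  Then s(x_j) is D or D + b − 1 = b F, and a common divisor of x_j with
-- D or F divides y_j, hence c, hence 1.  Such an A is D F (b^(2R) + b^R − 1), whose digit sum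
-- is s(D F) + R(b − 1); R can be adjusted since s(D F) ≡ D F ≡ 1 ≡ D modulo b − 1.  Letting L
-- grow gives infinitely many starting points.

module Submission where

open import Defs
open import Data.Nat
open import Data.Nat.Properties
open import Data.Nat.DivMod
open import Data.Nat.Divisibility
open import Data.Nat.Coprimality using (Coprime; coprime⇒gcd≡1; gcd≡1⇒coprime; coprime-divisor)
open import Data.Nat.Tactic.RingSolver using (solve-∀)
open import Data.Product using (_×_; _,_; proj₁; proj₂; ∃-syntax)
open import Data.Sum using (_⊎_; inj₁; inj₂)
open import Data.Empty using (⊥-elim)
open import Relation.Nullary using (¬_; yes; no)
open import Relation.Binary.PropositionalEquality

positive-multiple<double : ∀ {m t} → m ∣ t → 0 < t → t < m + m → t ≡ m
positive-multiple<double (divides zero          refl) ()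
positive-multiple<double (divides (suc zero)    refl) _ _ = +-identityʳ _
positive-multiple<double {m} (divides (suc (suc q)) refl) _ t<2m =
  ⊥-elim (<-irrefl refl (<-≤-trans t<2m (+-monoʳ-≤ m (m≤m+n m (q * m)))))

even-or-odd : ∀ m → 2 ∣ m ⊎ 2 ∣ suc m
even-or-odd zero    = inj₁ (divides 0 refl)
even-or-odd (suc m) with even-or-odd m
... | inj₁ (divides q eq) = inj₂ (divides (suc q) (cong (2 +_) eq))
... | inj₂ 2∣1+m          = inj₁ 2∣1+m

antiNiven⇒¬2∣both : ∀ {b x} → AntiNiven b x → 2 ∣ x → ¬ 2 ∣ s b x
antiNiven⇒¬2∣both (_ , gcd≡1) 2∣x 2∣sx with gcd≡1⇒coprime gcd≡1 (2∣x , 2∣sx)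
... | ()

∣n! : ∀ {m n} → 0 < m → m ≤ n → m ∣ n !
∣n! {suc m} _ m≤n = ∣-trans (divides (m !) (*-comm (suc m) (m !))) (m≤n⇒m!∣n! m≤n)

coprime-*ʳ : ∀ {m n o} → Coprime m n → Coprime m o → Coprime m (n * o)
coprime-*ʳ {m} {n} m⊥n m⊥o {d} (d∣m , d∣n*o) = m⊥o (d∣m , coprime-divisor d⊥n d∣n*o)
  where
  d⊥n : Coprime d n
  d⊥n (e∣d , e∣n) = m⊥n (∣-trans e∣d d∣m , e∣n)

coprime-pred-multiple : ∀ {m y z} → m ∣ suc y → m ∣ z → Coprime (y + z) m
coprime-pred-multiple {y = y} {z} m∣1+y m∣z {d} (d∣y+z , d∣m) =
  ∣1⇒≡1 (∣m+n∣m⇒∣n (subst (d ∣_) (+-comm 1 y) (∣-trans d∣m m∣1+y))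
                   (∣m+n∣m⇒∣n (subst (d ∣_) (+-comm y z) d∣y+z) (∣-trans d∣m m∣z)))

coprime-offset : ∀ {y c a} e z → y ∣ c → c * e + 1 ∣ a → Coprime (y + a * z) (c * e + 1)
coprime-offset {y} {c} {a} e z y∣c M∣a {d} (d∣y+az , d∣M) =
  ∣1⇒≡1 (∣m+n∣m⇒∣n d∣M (∣m⇒∣m*n e (∣-trans d∣y y∣c)))
  where
  d∣y : d ∣ y
  d∣y = ∣m+n∣m⇒∣n (subst (d ∣_) (+-comm y (a * z)) d∣y+az) (∣m⇒∣m*n z (∣-trans d∣M M∣a))

module Digits (k : ℕ) where

  b : ℕ
  b = suc (suc k)

  private
    digitSumFuel-zero : ∀ f → digitSumFuel k f 0 ≡ 0
    digitSumFuel-zero zero    = refl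
    digitSumFuel-zero (suc f) = digitSumFuel-zero f

    /b≤pred : ∀ x f → x ≤ suc f → x / b ≤ f
    /b≤pred zero    f _   = z≤n
    /b≤pred (suc x) f x≤ = ≤-pred (≤-trans (m/n<m (suc x) b (s≤s (s≤s z≤n))) x≤)

    digitSumFuel-stable : ∀ f g x → x ≤ f → x ≤ g → digitSumFuel k f x ≡ digitSumFuel k g x
    digitSumFuel-stable zero    g       .0 z≤n _   = sym (digitSumFuel-zero g)
    digitSumFuel-stable (suc f) zero    .0 _   z≤n = digitSumFuel-zero (suc f)
    digitSumFuel-stable (suc f) (suc g) x  x≤f x≤g =
      cong (x % b +_) (digitSumFuel-stable f g (x / b) (/b≤pred x f x≤f) (/b≤pred x g x≤g))

  s-step : ∀ x → s b x ≡ x % b + s b (x / b)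
  s-step zero    = refl
  s-step (suc x) = cong (suc x % b +_)
    (digitSumFuel-stable x (suc x / b) (suc x / b) (/b≤pred (suc x) x ≤-refl) ≤-refl)

  digit-ind : (P : ℕ → Set) → P 0 → (∀ x → P (x / b) → P x) → ∀ x → P x
  digit-ind P base step x = go x x ≤-refl
    where
    go : ∀ f x → x ≤ f → P x
    go zero    .0 z≤n = base
    go (suc f) x  x≤  = step x (go f (x / b) (/b≤pred x f x≤))

  s-cons : ∀ {r} q → r < b → s b (r + q * b) ≡ r + s b q
  s-cons {r} q r<b = begin
    s b (r + q * b)                                  ≡⟨ s-step (r + q * b) ⟩
    (r + q * b) % b + s b ((r + q * b) / b)          ≡⟨ cong₂ (λ u v → u + s b v) r%b q/b ⟩
    r + s b q                                        ∎
    where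
    open ≡-Reasoning
    r%b : (r + q * b) % b ≡ r
    r%b = trans ([m+kn]%n≡m%n r q b) (m<n⇒m%n≡m r<b)
    q/b : (r + q * b) / b ≡ q
    q/b = trans (+-distrib-/-∣ʳ r (divides q refl)) (cong₂ _+_ (m<n⇒m/n≡0 r<b) (m*n/n≡m q b))

  s-single : ∀ {r} → r < b → s b r ≡ r
  s-single {r} r<b = trans (cong (s b) (sym (+-identityʳ r))) (trans (s-cons 0 r<b) (+-identityʳ r))

  s-concat : ∀ L y a → y < b ^ L → s b (y + a * b ^ L) ≡ s b y + s b a
  s-concat zero    zero    a _  = cong (s b) (*-identityʳ a)
  s-concat zero    (suc y) a (s≤s ())
  s-concat (suc L) y       a y< = begin
    s b (y + a * (b * b ^ L))                  ≡⟨ cong (λ z → s b (z + a * (b * b ^ L))) (m≡m%n+[m/n]*n y b) ⟩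
    s b (y % b + y / b * b + a * (b * b ^ L))  ≡⟨ cong (s b) (regroup (y % b) (y / b) a (b ^ L) b) ⟩
    s b (y % b + (y / b + a * b ^ L) * b)      ≡⟨ s-cons (y / b + a * b ^ L) (m%n<n y b) ⟩
    y % b + s b (y / b + a * b ^ L)            ≡⟨ cong (y % b +_) (s-concat L (y / b) a q<) ⟩
    y % b + (s b (y / b) + s b a)              ≡⟨ +-assoc (y % b) _ _ ⟨
    y % b + s b (y / b) + s b a                ≡⟨ cong (_+ s b a) (s-step y) ⟨
    s b y + s b a                              ∎
    where
    open ≡-Reasoning
    q< : y / b < b ^ L
    q< = m<n*o⇒m/o<n (subst (y <_) (*-comm b (b ^ L)) y<)
    regroup : ∀ r q a p β → r + q * β + a * (β * p) ≡ r + (q + a * p) * β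
    regroup = solve-∀

  s-≤ : ∀ r x → x < b ^ r → s b x ≤ r * suc k
  s-≤ zero    zero    _  = z≤n
  s-≤ zero    (suc x) (s≤s ())
  s-≤ (suc r) x       x< = subst (_≤ suc k + r * suc k) (sym (s-step x))
    (+-mono-≤ (≤-pred (m%n<n x b)) (s-≤ r (x / b) (m<n*o⇒m/o<n (subst (x <_) (*-comm b (b ^ r)) x<))))

  s≡0⇒≡0 : ∀ x → s b x ≡ 0 → x ≡ 0
  s≡0⇒≡0 = digit-ind (λ x → s b x ≡ 0 → x ≡ 0) (λ _ → refl) step
    where
    step : ∀ x → (s b (x / b) ≡ 0 → x / b ≡ 0) → s b x ≡ 0 → x ≡ 0
    step x ih sx≡0 = begin
      x                  ≡⟨ m≡m%n+[m/n]*n x b ⟩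
      x % b + x / b * b  ≡⟨ cong₂ (λ r q → r + q * b) (m+n≡0⇒m≡0 (x % b) sum≡0) (ih (m+n≡0⇒n≡0 (x % b) sum≡0)) ⟩
      0                  ∎
      where
      open ≡-Reasoning
      sum≡0 : x % b + s b (x / b) ≡ 0
      sum≡0 = trans (sym (s-step x)) sx≡0

  s-congruent : ∀ x → ∃[ w ] x ≡ s b x + w * suc k
  s-congruent = digit-ind (λ x → ∃[ w ] x ≡ s b x + w * suc k) (0 , refl) step
    where
    step : ∀ x → ∃[ w ] x / b ≡ s b (x / b) + w * suc k → ∃[ w ] x ≡ s b x + w * suc k
    step x (w , eq) = w + x / b , (begin
      x                                        ≡⟨ m≡m%n+[m/n]*n x b ⟩
      x % b + x / b * b                        ≡⟨ cong (λ z → x % b + z * b) eq ⟩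
      x % b + (s b (x / b) + w * suc k) * b    ≡⟨ regroup (x % b) (s b (x / b)) w k ⟩
      x % b + s b (x / b) + (w + (s b (x / b) + w * suc k)) * suc k
                                               ≡⟨ cong₂ (λ u v → u + (w + v) * suc k) (sym (s-step x)) (sym eq) ⟩
      s b x + (w + x / b) * suc k              ∎)
      where
      open ≡-Reasoning
      regroup : ∀ r σ w k → r + (σ + w * suc k) * suc (suc k) ≡ r + σ + (w + (σ + w * suc k)) * suc k
      regroup = solve-∀

  s-complement : ∀ r W V → suc (W + V) ≡ b ^ r → s b W + s b V ≡ r * suc k
  s-complement zero    zero    zero    _  = refl
  s-complement zero    zero    (suc V) ()
  s-complement zero    (suc W) V       ()
  s-complement (suc r) W       V       eq = begin
    s b W + s b V                                    ≡⟨ cong₂ _+_ (s-step W) (s-step V) ⟩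
    W % b + s b (W / b) + (V % b + s b (V / b))      ≡⟨ interchange (W % b) (s b (W / b)) (V % b) _ ⟩
    W % b + V % b + (s b (W / b) + s b (V / b))      ≡⟨ cong₂ _+_ (suc-injective carry) (s-complement r (W / b) (V / b) high) ⟩
    suc k + r * suc k                                ∎
    where
    open ≡-Reasoning
    interchange : ∀ a b c d → a + b + (c + d) ≡ a + c + (b + d)
    interchange = solve-∀
    regroup : ∀ w v W V β → suc (w + W * β + (v + V * β)) ≡ suc (w + v) + (W + V) * β
    regroup = solve-∀
    split : suc (W % b + V % b) + (W / b + V / b) * b ≡ b ^ r * b
    split = begin
      suc (W % b + V % b) + (W / b + V / b) * b              ≡⟨ regroup (W % b) (V % b) (W / b) (V / b) b ⟨
      suc (W % b + W / b * b + (V % b + V / b * b))          ≡⟨ cong₂ (λ x y → suc (x + y)) (m≡m%n+[m/n]*n W b) (m≡m%n+[m/n]*n V b) ⟨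
      suc (W + V)                                            ≡⟨ eq ⟩
      b * b ^ r                                              ≡⟨ *-comm b (b ^ r) ⟩
      b ^ r * b                                              ∎
    carry : suc (W % b + V % b) ≡ b
    carry = positive-multiple<double
      (∣m+n∣m⇒∣n (subst (b ∣_) (+-comm (suc (W % b + V % b)) _) (divides (b ^ r) split)) (divides (W / b + V / b) refl))
      z<s
      (s≤s (subst (_≤ suc k + b) (+-suc (W % b) (V % b)) (+-mono-≤ (≤-pred (m%n<n W b)) (m%n<n V b))))
    high : suc (W / b + V / b) ≡ b ^ r
    high = *-cancelʳ-≡ _ _ b (trans (cong (_+ (W / b + V / b) * b) (sym carry)) split)

  s-suc : ∀ q → ¬ b ∣ suc q → s b (suc q) ≡ suc (s b q)
  s-suc q b∤ with m≤n⇒m<n∨m≡n (≤-pred (m%n<n q b))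
  ... | inj₂ q%b≡b-1 = ⊥-elim (b∤ (divides (suc (q / b)) (cong suc (begin
    q                  ≡⟨ m≡m%n+[m/n]*n q b ⟩
    q % b + q / b * b  ≡⟨ cong (_+ q / b * b) q%b≡b-1 ⟩
    suc k + q / b * b  ∎))))
    where open ≡-Reasoning
  ... | inj₁ q%b<b-1 = begin
    s b (suc q)                   ≡⟨ cong (λ z → s b (suc z)) (m≡m%n+[m/n]*n q b) ⟩
    s b (suc (q % b) + q / b * b) ≡⟨ s-cons (q / b) (s≤s q%b<b-1) ⟩
    suc (q % b + s b (q / b))     ≡⟨ cong suc (s-step q) ⟨
    suc (s b q)                   ∎
    where open ≡-Reasoning

  module _ (2∣b : 2 ∣ b) where

    antiNiven-pair⇒b∣suc : ∀ q → AntiNiven b (q * b) → AntiNiven b (q * b + 2 * suc k) → b ∣ suc q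
    antiNiven-pair⇒b∣suc q an₀ an₂ with b ∣? suc q
    ... | yes b∣1+q = b∣1+q
    ... | no  b∤1+q with even-or-odd (s b q)
    ...   | inj₁ 2∣sq  = ⊥-elim (antiNiven⇒¬2∣both an₀ (∣n⇒∣m*n q 2∣b) (subst (2 ∣_) (sym (s-cons q z<s)) 2∣sq))
    ...   | inj₂ 2∣1+sq = ⊥-elim (antiNiven⇒¬2∣both an₂
                            (∣m∣n⇒∣m+n (∣n⇒∣m*n q 2∣b) (∣m⇒∣m*n (suc k) ∣-refl))
                            (subst (2 ∣_) (sym digitSum) (∣m∣n⇒∣m+n (∣m+n∣m⇒∣n 2∣b ∣-refl) 2∣1+sq)))
      where
      regroup : ∀ q k → q * suc (suc k) + 2 * suc k ≡ k + suc q * suc (suc k)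
      regroup = solve-∀
      digitSum : s b (q * b + 2 * suc k) ≡ k + suc (s b q)
      digitSum = trans (cong (s b) (regroup q k)) (trans (s-cons (suc q) (m<n⇒m<1+n (n<1+n k)))
                   (cong (k +_) (s-suc q b∤1+q)))

    aligned : ∀ n j → n + (n % b + j * b) * suc k ≡ (n / b + n % b + j * suc k) * b
    aligned n j = begin
      n + (n % b + j * b) * suc k                    ≡⟨ cong (λ z → z + (n % b + j * b) * suc k) (m≡m%n+[m/n]*n n b) ⟩
      n % b + n / b * b + (n % b + j * b) * suc k    ≡⟨ regroup (n % b) (n / b) j k ⟩
      (n / b + n % b + j * suc k) * b                ∎
      where
      open ≡-Reasoning
      regroup : ∀ i q j k → i + q * suc (suc k) + (i + j * suc (suc k)) * suc k ≡ (q + i + j * suc k) * suc (suc k)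
      regroup = solve-∀

    ap⇒b∣suc : ∀ {n t} j → APAntiNiven b n t → 2 + (n % b + j * b) < t → b ∣ suc (n / b + n % b + j * suc k)
    ap⇒b∣suc {n} j ap lt = antiNiven-pair⇒b∣suc (n / b + n % b + j * suc k)
      (subst (AntiNiven b) (aligned n j) (ap i (<-trans (m<n+m i {2} z<s) lt)))
      (subst (AntiNiven b) (trans (two-later n i k) (cong (_+ 2 * suc k) (aligned n j))) (ap (2 + i) lt))
      where
      i = n % b + j * b
      two-later : ∀ n i k → n + (2 + i) * suc k ≡ n + i * suc k + 2 * suc k
      two-later = solve-∀

    ap-length≤ : ∀ n t → APAntiNiven b n t → t ≤ 2 * b + 1
    ap-length≤ n t ap with t ≤? 2 * b + 1
    ... | yes t≤ = t≤
    ... | no  t≰ = ⊥-elim (<⇒≱ (n<1+n (suc k)) (∣⇒≤ b∣b-1))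
      where
      late< : 2 + (n % b + 1 * b) < t
      late< = ≤-<-trans (subst (2 + (n % b + 1 * b) ≤_) (top k) (+-monoʳ-≤ 2 (+-monoˡ-≤ (1 * b) (≤-pred (m%n<n n b))))) (≰⇒> t≰)
        where
        top : ∀ k → 2 + (suc k + 1 * suc (suc k)) ≡ 2 * suc (suc k) + 1
        top = solve-∀
      early< : 2 + (n % b + 0 * b) < t
      early< = ≤-<-trans (+-monoʳ-≤ 2 (+-monoʳ-≤ (n % b) z≤n)) late<
      b∣b-1 : b ∣ suc k
      b∣b-1 = ∣m+n∣m⇒∣n (subst (b ∣_) (later (n / b + n % b) k) (ap⇒b∣suc 1 ap late<)) (ap⇒b∣suc 0 ap early<)
        where
        later : ∀ q k → suc (q + 1 * suc k) ≡ suc (q + 0 * suc k) + suc k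
        later = solve-∀

  s-[1+j]*[b-1]-low : ∀ j {m} → j + m ≡ suc k → s b (suc j * suc k) ≡ suc k
  s-[1+j]*[b-1]-low j {m} j+m≡b-1 = begin
    s b (suc j * suc k)  ≡⟨ cong (s b) digits ⟩
    s b (m + j * b)      ≡⟨ s-cons j (s≤s (subst (m ≤_) j+m≡b-1 (m≤n+m m j))) ⟩
    m + s b j            ≡⟨ cong (m +_) (s-single (s≤s (subst (j ≤_) j+m≡b-1 (m≤m+n j m)))) ⟩
    m + j                ≡⟨ +-comm m j ⟩
    j + m                ≡⟨ j+m≡b-1 ⟩
    suc k                ∎
    where
    open ≡-Reasoning
    expand : ∀ j m → suc j * (j + m) ≡ m + j * suc (j + m)
    expand = solve-∀
    digits : suc j * suc k ≡ m + j * b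
    digits = subst (λ K → suc j * K ≡ m + j * suc K) j+m≡b-1 (expand j m)

  s-[1+j]*[b-1]-high : ∀ i {m} → i + m ≡ k → s b (suc (b + suc i) * suc k) ≡ suc k
  s-[1+j]*[b-1]-high i {m} i+m≡k = begin
    s b (suc (b + suc i) * suc k)  ≡⟨ cong (s b) digits ⟩
    s b (m + (i + 1 * b) * b)      ≡⟨ s-cons (i + 1 * b) (s≤s (m≤n⇒m≤1+n (subst (m ≤_) i+m≡k (m≤n+m m i)))) ⟩
    m + s b (i + 1 * b)            ≡⟨ cong (m +_) (s-cons 1 (m<n⇒m<1+n (s≤s (subst (i ≤_) i+m≡k (m≤m+n i m))))) ⟩
    m + (i + s b 1)                ≡⟨ cong (λ z → m + (i + z)) (s-single (s≤s z<s)) ⟩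
    m + (i + 1)                    ≡⟨ count i m ⟩
    suc (i + m)                    ≡⟨ cong suc i+m≡k ⟩
    suc k                          ∎
    where
    open ≡-Reasoning
    expand : ∀ i m → suc (suc (suc (i + m)) + suc i) * suc (i + m) ≡ m + (i + 1 * suc (suc (i + m))) * suc (suc (i + m))
    expand = solve-∀
    count : ∀ i m → m + (i + 1) ≡ suc (i + m)
    count = solve-∀
    digits : suc (b + suc i) * suc k ≡ m + (i + 1 * b) * b
    digits = subst (λ K → suc (suc (suc K) + suc i) * suc K ≡ m + (i + 1 * suc (suc K)) * suc (suc K)) i+m≡k (expand i m)

  s-[b+1]*[b-1] : s b (suc (b + 0) * suc k) ≡ 2 * suc k × b ∣ suc (suc (b + 0) * suc k)
  s-[b+1]*[b-1] = digitSum , divides b (square k)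
    where
    open ≡-Reasoning
    digits : ∀ k → suc (suc (suc k) + 0) * suc k ≡ suc k + suc k * suc (suc k)
    digits = solve-∀
    square : ∀ k → suc (suc (suc (suc k) + 0) * suc k) ≡ suc (suc k) * suc (suc k)
    square = solve-∀
    digitSum : s b (suc (b + 0) * suc k) ≡ 2 * suc k
    digitSum = begin
      s b (suc (b + 0) * suc k)    ≡⟨ cong (s b) (digits k) ⟩
      s b (suc k + suc k * b)      ≡⟨ s-cons (suc k) ≤-refl ⟩
      suc k + s b (suc k)          ≡⟨ cong (suc k +_) (s-single ≤-refl) ⟩
      suc k + suc k                ≡⟨ cong (suc k +_) (+-identityʳ (suc k)) ⟨
      2 * suc k                    ∎

  s-[2b+1]*[b-1] : s b (suc (b + b) * suc k) ≡ 2 * suc k × b ∣ suc (suc (b + b) * suc k)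
  s-[2b+1]*[b-1] = digitSum , divides (suc (suc (suc (k + k)))) (product k)
    where
    open ≡-Reasoning
    digits : ∀ k → suc (suc (suc k) + suc (suc k)) * suc k ≡ suc k + (k + 1 * suc (suc k)) * suc (suc k)
    digits = solve-∀
    product : ∀ k → suc (suc (suc (suc k) + suc (suc k)) * suc k) ≡ suc (suc (suc (k + k))) * suc (suc k)
    product = solve-∀
    count : ∀ k → suc k + (k + 1) ≡ 2 * suc k
    count = solve-∀
    digitSum : s b (suc (b + b) * suc k) ≡ 2 * suc k
    digitSum = begin
      s b (suc (b + b) * suc k)          ≡⟨ cong (s b) (digits k) ⟩
      s b (suc k + (k + 1 * b) * b)      ≡⟨ s-cons (k + 1 * b) ≤-refl ⟩
      suc k + s b (k + 1 * b)            ≡⟨ cong (suc k +_) (s-cons 1 (m<n⇒m<1+n (n<1+n k))) ⟩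
      suc k + (k + s b 1)                ≡⟨ cong (λ z → suc k + (k + z)) (s-single (s≤s z<s)) ⟩
      suc k + (k + 1)                    ≡⟨ count k ⟩
      2 * suc k                          ∎

  s-[1+j]*[b-1] : ∀ j → j ≤ 2 * b →
    s b (suc j * suc k) ≡ suc k ⊎ (s b (suc j * suc k) ≡ 2 * suc k × b ∣ suc (suc j * suc k))
  s-[1+j]*[b-1] j j≤2b with j ≤? suc k
  ... | yes j≤b-1 = inj₁ (s-[1+j]*[b-1]-low j (proj₂ (m≤n⇒∃[o]m+o≡n j≤b-1)))
  ... | no  j≰b-1 with m≤n⇒∃[o]m+o≡n (≰⇒> j≰b-1)
  ...   | zero  , refl = inj₂ s-[b+1]*[b-1]
  ...   | suc i , refl with i ≤? k
  ...     | yes i≤k = inj₁ (s-[1+j]*[b-1]-high i (proj₂ (m≤n⇒∃[o]m+o≡n i≤k)))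
  ...     | no  i≰k with ≤-antisym (≤-pred (subst (suc i ≤_) (+-identityʳ b) (+-cancelˡ-≤ b (suc i) (b + 0) j≤2b))) (≰⇒> i≰k)
  ...       | refl = inj₂ s-[2b+1]*[b-1]

  n<b^n : ∀ n → n < b ^ n
  n<b^n zero    = s≤s z≤n
  n<b^n (suc n) = ≤-trans (+-mono-≤ (m^n>0 b n) (n<b^n n)) (subst (b ^ n + b ^ n ≤_) (sym (expand (b ^ n) k)) (m≤m+n _ _))
    where
    expand : ∀ x k → suc (suc k) * x ≡ x + x + k * x
    expand = solve-∀

  multiple-with-digitSum : ∀ W R → suc W ≤ b ^ R →
    ∃[ A ] suc W ∣ A × 0 < A × s b A ≡ R * suc k + s b (suc W)
  multiple-with-digitSum W R G≤b^R = low + G * b ^ (R + R) , G∣A , A>0 , digitSum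
    -- the multiple is G (b^(2R) + b^R − 1); its lower R-digit blocks G − 1 and b^R − G add up to b^R − 1
    where
    G = suc W
    V = proj₁ (m≤n⇒∃[o]m+o≡n G≤b^R)
    G+V≡b^R : G + V ≡ b ^ R
    G+V≡b^R = proj₂ (m≤n⇒∃[o]m+o≡n G≤b^R)
    low = V + W * b ^ R
    V<b^R : V < b ^ R
    V<b^R = subst (V <_) G+V≡b^R (m<n+m V z<s)
    G*b^R≡G+low : G * b ^ R ≡ G + low
    G*b^R≡G+low = begin
      b ^ R + W * b ^ R      ≡⟨ cong (_+ W * b ^ R) G+V≡b^R ⟨
      G + V + W * b ^ R      ≡⟨ +-assoc G V (W * b ^ R) ⟩
      G + low                ∎
      where open ≡-Reasoning
    low<b^2R : low < b ^ (R + R)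
    low<b^2R = begin-strict
      V + W * b ^ R          <⟨ +-monoˡ-< (W * b ^ R) V<b^R ⟩
      G * b ^ R              ≤⟨ *-monoˡ-≤ (b ^ R) G≤b^R ⟩
      b ^ R * b ^ R          ≡⟨ ^-distribˡ-+-* b R R ⟨
      b ^ (R + R)            ∎
      where open ≤-Reasoning
    G∣A : G ∣ low + G * b ^ (R + R)
    G∣A = ∣m∣n⇒∣m+n (∣m+n∣m⇒∣n (subst (G ∣_) G*b^R≡G+low (m∣m*n (b ^ R))) ∣-refl) (m∣m*n (b ^ (R + R)))
    A>0 : 0 < low + G * b ^ (R + R)
    A>0 = ≤-trans (≤-trans (m^n>0 b (R + R)) (m≤m+n _ _)) (m≤n+m _ low)
    digitSum : s b (low + G * b ^ (R + R)) ≡ R * suc k + s b G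
    digitSum = begin
      s b (low + G * b ^ (R + R))  ≡⟨ s-concat (R + R) low G low<b^2R ⟩
      s b low + s b G              ≡⟨ cong (_+ s b G) (s-concat R V W V<b^R) ⟩
      s b V + s b W + s b G        ≡⟨ cong (_+ s b G) (+-comm (s b V) (s b W)) ⟩
      s b W + s b V + s b G        ≡⟨ cong (_+ s b G) (s-complement R W V G+V≡b^R) ⟩
      R * suc k + s b G            ∎
      where open ≡-Reasoning

  s≡1[mod-b-1] : ∀ z r → suc (z * suc k) < b ^ r → ∃[ u ] u < r × s b (suc (z * suc k)) ≡ suc (u * suc k)
  s≡1[mod-b-1] z r G<b^r = u , u<r , sG≡
    where
    G = suc (z * suc k)
    σ≡1 : ∀ {σ} w → G ≡ σ + w * suc k → σ ≢ 0 → ∃[ u ] σ ≡ suc (u * suc k)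
    σ≡1 {zero}  _ _  σ≢0 = ⊥-elim (σ≢0 refl)
    σ≡1 {suc τ} w eq _   = _∣_.quotient b-1∣τ , cong suc (_∣_.equality b-1∣τ)
      where
      b-1∣τ : suc k ∣ τ
      b-1∣τ = ∣m+n∣m⇒∣n (subst (suc k ∣_) (+-comm τ (w * suc k)) (divides z (sym (suc-injective eq)))) (divides w refl)
    sG≡1 : ∃[ u ] s b G ≡ suc (u * suc k)
    sG≡1 = σ≡1 (proj₁ (s-congruent G)) (proj₂ (s-congruent G)) (λ sG≡0 → 1+n≢0 (s≡0⇒≡0 G sG≡0))
    u = proj₁ sG≡1
    sG≡ : s b G ≡ suc (u * suc k)
    sG≡ = proj₂ sG≡1
    u<r : u < r
    u<r = *-cancelʳ-< (suc k) u r (subst (_≤ r * suc k) sG≡ (s-≤ r G G<b^r))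

  multiple-with-prescribed-digitSum : ∀ {G} z r X → suc (z * suc k) ≡ G → G < b ^ r → 2 * r ≤ X →
    ∃[ A ] G ∣ A × 0 < A × suc k + s b A ≡ suc (X * suc k)
  multiple-with-prescribed-digitSum z r X refl G<b^r 2r≤X = A , G∣A , A>0 , (begin
    suc k + s b A                                      ≡⟨ cong (suc k +_) sA≡ ⟩
    suc k + ((r + o) * suc k + s b (suc (z * suc k)))  ≡⟨ cong (λ v → suc k + ((r + o) * suc k + v)) sG≡ ⟩
    suc k + ((r + o) * suc k + suc (u * suc k))        ≡⟨ collect k r o u ⟩
    suc ((suc (u + r) + o) * suc k)                    ≡⟨ cong (λ v → suc (v * suc k)) u+r+o≡X ⟩
    suc (X * suc k)                                    ∎)
    where
    open ≡-Reasoning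
    collect : ∀ k r o u → suc k + ((r + o) * suc k + suc (u * suc k)) ≡ suc ((suc (u + r) + o) * suc k)
    collect = solve-∀
    u = proj₁ (s≡1[mod-b-1] z r G<b^r)
    u<r : u < r
    u<r = proj₁ (proj₂ (s≡1[mod-b-1] z r G<b^r))
    sG≡ : s b (suc (z * suc k)) ≡ suc (u * suc k)
    sG≡ = proj₂ (proj₂ (s≡1[mod-b-1] z r G<b^r))
    room : suc (u + r) ≤ X
    room = ≤-trans (+-monoˡ-≤ r u<r) (subst (_≤ X) (cong (r +_) (+-identityʳ r)) 2r≤X)
    o = proj₁ (m≤n⇒∃[o]m+o≡n room)
    u+r+o≡X : suc (u + r) + o ≡ X
    u+r+o≡X = proj₂ (m≤n⇒∃[o]m+o≡n room)
    multiple = multiple-with-digitSum (z * suc k) (r + o) (≤-trans (<⇒≤ G<b^r) (^-monoʳ-≤ b (m≤m+n r o)))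
    A = proj₁ multiple
    G∣A : suc (z * suc k) ∣ A
    G∣A = proj₁ (proj₂ multiple)
    A>0 : 0 < A
    A>0 = proj₁ (proj₂ (proj₂ multiple))
    sA≡ : s b A ≡ (r + o) * suc k + s b (suc (z * suc k))
    sA≡ = proj₂ (proj₂ (proj₂ multiple))

  [1+j]*[b-1]<b^3 : ∀ j → j ≤ 2 * b → suc j * suc k < b ^ 3
  [1+j]*[b-1]<b^3 j j≤2b = begin-strict
    suc j * suc k                                            ≤⟨ *-monoˡ-≤ (suc k) (s≤s j≤2b) ⟩
    suc (2 * b) * suc k                                      <⟨ m≤m+n _ (k * k * k + 4 * k * k + 5 * k + 2) ⟩
    suc (suc (2 * b) * suc k) + (k * k * k + 4 * k * k + 5 * k + 2)  ≡⟨ cube k ⟩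
    b ^ 3                                                    ∎
    where
    open ≤-Reasoning
    cube : ∀ k → suc (suc (2 * suc (suc k)) * suc k) + (k * k * k + 4 * k * k + 5 * k + 2) ≡ suc (suc k) * (suc (suc k) * (suc (suc k) * 1))
    cube = solve-∀

  module _ (c e : ℕ) (y∣c : ∀ j → j ≤ 2 * b → suc j * suc k ∣ c) where

    ap-from-multiple : ∀ A L → c * (b * e) + 1 ∣ A → c * e + 1 ∣ A → suc k + s b A ≡ c * (b * e) + 1 →
      APAntiNiven b (suc k + A * b ^ (3 + L)) (2 * b + 1)
    ap-from-multiple A L D∣A F∣A b-1+sA≡D j j<2b+1 = subst (AntiNiven b) (sym (shift A j z k)) (z<s , coprime⇒gcd≡1 coprime)
      where
      y = suc j * suc k
      z = b ^ (3 + L)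
      shift : ∀ A j z k → suc k + A * z + j * suc k ≡ suc j * suc k + A * z
      shift = solve-∀
      j≤2b : j ≤ 2 * b
      j≤2b = ≤-pred (subst (suc j ≤_) (+-comm (2 * b) 1) j<2b+1)
      sx≡ : s b (y + A * z) ≡ s b y + s b A
      sx≡ = s-concat (3 + L) y A (<-≤-trans ([1+j]*[b-1]<b^3 j j≤2b) (^-monoʳ-≤ b (m≤m+n 3 L)))
      coprime : Coprime (y + A * z) (s b (y + A * z))
      coprime with s-[1+j]*[b-1] j j≤2b
      ... | inj₁ sy≡b-1 = subst (Coprime (y + A * z)) (sym sx≡D) (coprime-offset (b * e) z (y∣c j j≤2b) D∣A)
        where
        sx≡D : s b (y + A * z) ≡ c * (b * e) + 1
        sx≡D = trans sx≡ (trans (cong (_+ s b A) sy≡b-1) b-1+sA≡D)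
      ... | inj₂ (sy≡ , b∣1+y) = subst (Coprime (y + A * z)) (sym sx≡bF)
              (coprime-*ʳ (coprime-pred-multiple b∣1+y (∣n⇒∣m*n A (m∣m*n (b ^ (2 + L)))))
                          (coprime-offset e z (y∣c j j≤2b) F∣A))
        where
        open ≡-Reasoning
        regroup : ∀ k σ → 2 * suc k + σ ≡ suc k + (suc k + σ)
        regroup = solve-∀
        factor : ∀ k c e → suc k + (c * (suc (suc k) * e) + 1) ≡ suc (suc k) * (c * e + 1)
        factor = solve-∀
        sx≡bF : s b (y + A * z) ≡ b * (c * e + 1)
        sx≡bF = begin
          s b (y + A * z)                  ≡⟨ sx≡ ⟩
          s b y + s b A                    ≡⟨ cong (_+ s b A) sy≡ ⟩
          2 * suc k + s b A                ≡⟨ regroup k (s b A) ⟩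
          suc k + (suc k + s b A)          ≡⟨ cong (suc k +_) b-1+sA≡D ⟩
          suc k + (c * (b * e) + 1)        ≡⟨ factor k c e ⟩
          b * (c * e + 1)                  ∎

  c*b^e+1≤b^[c+e] : ∀ c e → c * b ^ e + 1 ≤ b ^ (c + e)
  c*b^e+1≤b^[c+e] c e = begin
    c * b ^ e + 1        ≤⟨ +-monoʳ-≤ (c * b ^ e) (m^n>0 b e) ⟩
    c * b ^ e + b ^ e    ≡⟨ +-comm (c * b ^ e) (b ^ e) ⟩
    suc c * b ^ e        ≤⟨ *-monoˡ-≤ (b ^ e) (n<b^n c) ⟩
    b ^ c * b ^ e        ≡⟨ ^-distribˡ-+-* b c e ⟨
    b ^ (c + e)          ∎
    where open ≤-Reasoning

  4[b-1]+28≤b^7 : 4 * suc k + 28 ≤ b ^ 7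
  4[b-1]+28≤b^7 = begin
    4 * suc k + 28                   ≤⟨ m≤m+n _ (60 * k + 96) ⟩
    4 * suc k + 28 + (60 * k + 96)   ≡⟨ expand k ⟩
    b * 2 ^ 6                        ≤⟨ *-monoʳ-≤ b (^-monoˡ-≤ 6 {2} {b} (s≤s (s≤s z≤n))) ⟩
    b ^ 7                            ∎
    where
    open ≤-Reasoning
    expand : ∀ k → 4 * suc k + 28 + (60 * k + 96) ≡ suc (suc k) * 64
    expand = solve-∀

  -- The exponents 7 and 6 just make D large: (D − 1)/(b − 1) = c′ b^7 must be at least twice the digit bound r of D F.
  module Witness (c′ : ℕ) (1≤c′ : 1 ≤ c′) (∣c′ : ∀ j → j ≤ 2 * b → suc j ∣ c′) where
    c : ℕ
    c = c′ * suc k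
    D : ℕ
    D = c * b ^ 7 + 1
    F : ℕ
    F = c * b ^ 6 + 1
    r : ℕ
    r = suc ((c + 7) + (c + 6))

    y∣c : ∀ j → j ≤ 2 * b → suc j * suc k ∣ c
    y∣c j j≤2b = *-monoˡ-∣ (suc k) (∣c′ j j≤2b)

    Q : ℕ
    Q = c′ * (c * (b ^ 7 * b ^ 6) + b ^ 7 + b ^ 6)

    D*F≡1[mod-b-1] : suc (Q * suc k) ≡ D * F
    D*F≡1[mod-b-1] = expand c′ (suc k) (b ^ 7) (b ^ 6)
      where
      expand : ∀ c′ s p q → suc (c′ * (c′ * s * (p * q) + p + q) * s) ≡ (c′ * s * p + 1) * (c′ * s * q + 1)
      expand = solve-∀

    D≡1[mod-b-1] : D ≡ suc (c′ * b ^ 7 * suc k)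
    D≡1[mod-b-1] = expand c′ (suc k) (b ^ 7)
      where
      expand : ∀ c′ s p → c′ * s * p + 1 ≡ suc (c′ * p * s)
      expand = solve-∀

    D*F<b^r : D * F < b ^ r
    D*F<b^r = begin-strict
      D * F                         ≤⟨ *-mono-≤ (c*b^e+1≤b^[c+e] c 7) (c*b^e+1≤b^[c+e] c 6) ⟩
      b ^ (c + 7) * b ^ (c + 6)     ≡⟨ ^-distribˡ-+-* b (c + 7) (c + 6) ⟨
      b ^ ((c + 7) + (c + 6))       <⟨ ^-monoʳ-< b (s≤s (s≤s z≤n)) (n<1+n ((c + 7) + (c + 6))) ⟩
      b ^ r                         ∎
      where open ≤-Reasoning

    2r≤c′*b^7 : 2 * r ≤ c′ * b ^ 7
    2r≤c′*b^7 = begin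
      2 * r                              ≡⟨ expand c′ k ⟩
      c′ * (4 * suc k) + 28 * 1          ≤⟨ +-monoʳ-≤ (c′ * (4 * suc k)) (*-monoʳ-≤ 28 1≤c′) ⟩
      c′ * (4 * suc k) + 28 * c′         ≡⟨ factor c′ k ⟩
      c′ * (4 * suc k + 28)              ≤⟨ *-monoʳ-≤ c′ 4[b-1]+28≤b^7 ⟩
      c′ * b ^ 7                         ∎
      where
      open ≤-Reasoning
      expand : ∀ c′ k → 2 * suc (c′ * suc k + 7 + (c′ * suc k + 6)) ≡ c′ * (4 * suc k) + 28 * 1
      expand = solve-∀
      factor : ∀ c′ k → c′ * (4 * suc k) + 28 * c′ ≡ c′ * (4 * suc k + 28)
      factor = solve-∀

    multiple : ∃[ A ] D * F ∣ A × 0 < A × suc k + s b A ≡ suc (c′ * b ^ 7 * suc k)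
    multiple = multiple-with-prescribed-digitSum Q r (c′ * b ^ 7) D*F≡1[mod-b-1] D*F<b^r 2r≤c′*b^7
    A : ℕ
    A = proj₁ multiple
    A>0 : 0 < A
    A>0 = proj₁ (proj₂ (proj₂ multiple))
    DF∣A : D * F ∣ A
    DF∣A = proj₁ (proj₂ multiple)
    D∣A : D ∣ A
    D∣A = ∣-trans (m∣m*n F) DF∣A
    F∣A : F ∣ A
    F∣A = ∣-trans (n∣m*n D) DF∣A
    b-1+sA≡D : suc k + s b A ≡ D
    b-1+sA≡D = trans (proj₂ (proj₂ (proj₂ multiple))) (sym D≡1[mod-b-1])

    ap-unbounded : ∀ m → ∃[ n ] (m < n × APAntiNiven b n (2 * b + 1))
    ap-unbounded m = suc k + A * b ^ (3 + m) , m<n , ap-from-multiple c (b ^ 6) y∣c A m D∣A F∣A b-1+sA≡D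
      where
      m<n : m < suc k + A * b ^ (3 + m)
      m<n = <-≤-trans (<-trans (m<n+m m {3} z<s) (n<b^n (3 + m)))
              (≤-trans (m≤n*m (b ^ (3 + m)) A {{>-nonZero A>0}}) (m≤n+m _ (suc k)))

  1+j∣[2b+1]! : ∀ j → j ≤ 2 * b → suc j ∣ (2 * b + 1) !
  1+j∣[2b+1]! j j≤2b = ∣n! z<s (subst (suc j ≤_) (+-comm 1 (2 * b)) (s≤s j≤2b))

  ap-unbounded : ∀ m → ∃[ n ] (m < n × APAntiNiven b n (2 * b + 1))
  ap-unbounded = Witness.ap-unbounded ((2 * b + 1) !) (1≤n! (2 * b + 1)) 1+j∣[2b+1]!

theorem3p5 : ∀ (b : ℕ) → 2 ≤ b → 2 ∣ b →
    ((∃[ n ] APAntiNiven b n (2 * b + 1))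
    × (∀ n t → APAntiNiven b n t → t ≤ 2 * b + 1))
    × (∀ m → ∃[ n ] (m < n × APAntiNiven b n (2 * b + 1)))
theorem3p5 zero          ()
theorem3p5 (suc zero)    (s≤s ())
theorem3p5 (suc (suc k)) _ 2∣b = (some-ap , ap-length≤ 2∣b) , ap-unbounded
  where
  open Digits k
  some-ap : ∃[ n ] APAntiNiven b n (2 * b + 1)
  some-ap = proj₁ (ap-unbounded 0) , proj₂ (proj₂ (ap-unbounded 0))
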